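{- Let $d\in\mathbb{N}$ and let $G$ be a finite graph with vertices $v_0,v_1$ whose distance is at most $d/2$ and at least three; let $C=C_d(v_0,v_1,G)$. If $x$ and $y$ are neighbours of $v_0$ in the explorer neighbourhood $Ex_d(v_0,v_1)$ that lie in the same component of $Ex_d(v_0,v_1)-v_0-v_1$, then $x'$ and $y'$ lie in the same component of $C$.
   Context: All graphs are finite, without loops or parallel edges. For a vertex $v$ and $d\in\mathbb{N}$, the ball $D_d(v)$ is the subgraph of $G$ consisting of all vertices and edges of $G$ lying on some closed walk of length at most $d$ containing $v$. For vertices $v,w$ of distance at most $d/2$, the explorer neighbourhood $Ex_d(v,w)$ is defined as follows. The core is the set of all vertices on shortest $v$–$w$ paths in $G$. Take a copy of $D_d(v)$ in which each vertex $u$ is labelled with the set of shortest paths from the core to $u$ contained in $D_d(v)$, and a copy of $D_d(w)$ in which each vertex $u$ is labelled with the set of shortest paths from the core to $u$ contained in $D_d(w)$. $Ex_d(v,w)$ is the union of these two labelled balls, where two vertices (copies of the same vertex of $G$) are identified if their label sets share an element. For a vertex $x$ of $Ex_d(v,w)$, $x'$ denotes the vertex of $G$ of which $x$ is a copy. Core vertices (in particular $v,w$) have unique copies, denoted by the same letters. For $X\subseteq V(G)$, $N(X)$ is the set of vertices outside $X$ with a neighbour in $X$. The connectivity graph $C_d(v_0,v_1,G)$ has vertex set $N(\{v_0,v_1\})$, and $xy$ is an edge if there is an $x$–$y$ path in $D_d(v_i)-v_0-v_1$ for some $i\in\{0,1\}$. -}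

module Defs where

open import Data.Nat using (ℕ; _≤_; _*_; _∸_)
open import Data.Fin using (Fin)
open import Data.Bool using (Bool; true; false; T)
open import Data.List using (List; []; _∷_; _++_; length; head; last)
open import Data.List.Relation.Unary.All using (All)
open import Data.List.Relation.Unary.Linked using (Linked)
open import Data.List.Relation.Unary.Unique.Propositional using (Unique)
open import Data.List.Membership.Propositional using (_∈_)
open import Data.Maybe using (just)
open import Data.Product using (Σ; ∃; _×_; _,_; proj₁; proj₂)
open import Data.Sum using (_⊎_)
open import Relation.Nullary using (¬_)
open import Relation.Binary.PropositionalEquality using (_≡_; _≢_)

record Graph (n : ℕ) : Set where
  field
    adj    : Fin n → Fin n → Bool
    sym    : ∀ u v → adj u v ≡ adj v u
    irrefl : ∀ u → adj u u ≡ false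

module _ {n : ℕ} (G : Graph n) where

  V : Set
  V = Fin n

  Adj : V → V → Set
  Adj u v = T (Graph.adj G u v)

  -- a walk is the list of its vertices; its length is the number of edges
  IsWalkFrom : V → V → List V → Set
  IsWalkFrom u v xs = Linked Adj xs × head xs ≡ just u × last xs ≡ just v

  wlen : List V → ℕ
  wlen xs = length xs ∸ 1

  IsPathFrom : V → V → List V → Set
  IsPathFrom u v xs = IsWalkFrom u v xs × Unique xs

  Dist≤ : V → V → ℕ → Set
  Dist≤ u v k = ∃ λ xs → IsWalkFrom u v xs × wlen xs ≤ k

  ShortestPath : V → V → List V → Set
  ShortestPath u v xs =
    IsPathFrom u v xs × (∀ ys → IsWalkFrom u v ys → wlen xs ≤ wlen ys)

  Core : V → V → V → Set
  Core v w c = ∃ λ xs → ShortestPath v w xs × c ∈ xs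

  ClosedWalk : List V → Set
  ClosedWalk xs = ∃ λ u → IsWalkFrom u u xs

  EdgeIn : V → V → List V → Set
  EdgeIn a b xs = ∃ λ ys → ∃ λ zs → xs ≡ ys ++ (a ∷ b ∷ zs)

  BallV : ℕ → V → V → Set
  BallV d v u = ∃ λ xs → ClosedWalk xs × wlen xs ≤ d × v ∈ xs × u ∈ xs

  BallE : ℕ → V → V → V → Set
  BallE d v a b = ∃ λ xs → ClosedWalk xs × wlen xs ≤ d × v ∈ xs ×
                     (EdgeIn a b xs ⊎ EdgeIn b a xs)

  InBall : ℕ → V → List V → Set
  InBall d z xs = All (BallV d z) xs × Linked (BallE d z) xs

  ShortestFromCore : V → V → V → List V → Set
  ShortestFromCore v w u xs =
    ∃ λ c → Core v w c × IsPathFrom c u xs ×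
      (∀ c' ys → Core v w c' → IsWalkFrom c' u ys → wlen xs ≤ wlen ys)

  module Explorer (d : ℕ) (v₀ v₁ : V) where

    -- copy false = copy inside D_d(v₀), copy true = copy inside D_d(v₁)
    center : Bool → V
    center false = v₀
    center true  = v₁

    Label : Bool → V → List V → Set
    Label b u xs = ShortestFromCore v₀ v₁ u xs × InBall d (center b) xs

    -- candidate vertices of Ex_d(v₀,v₁): (copy, vertex of G)
    ExPre : Set
    ExPre = Bool × V

    IsExV : ExPre → Set
    IsExV (b , u) = BallV d (center b) u

    -- identification of copies (vertices of Ex are classes of this relation)
    Ident : ExPre → ExPre → Set
    Ident (b , u) (b' , u') =
      u ≡ u' × (b ≡ b' ⊎ ∃ λ xs → Label b u xs × Label b' u xs)

    ExAdj : ExPre → ExPre → Set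
    ExAdj p q = ∃ λ b → ∃ λ a → ∃ λ c →
      Ident p (b , a) × Ident q (b , c) × BallE d (center b) a c

    exv₀ exv₁ : ExPre
    exv₀ = (false , v₀)
    exv₁ = (true , v₁)

    Removed : ExPre → Set
    Removed p = Ident p exv₀ ⊎ Ident p exv₁

    -- p and q lie in the same component of Ex_d(v₀,v₁) - v₀ - v₁
    -- (walk through representatives; a step is an identification or an edge)
    SameCompExMinus : ExPre → ExPre → Set
    SameCompExMinus p q = ∃ λ ps →
      All (λ r → IsExV r × ¬ Removed r) ps ×
      Linked (λ r s → Ident r s ⊎ ExAdj r s) ps ×
      head ps ≡ just p × last ps ≡ just q

    CVert : V → Set
    CVert z = z ≢ v₀ × z ≢ v₁ × (Adj z v₀ ⊎ Adj z v₁)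

    CAdj : V → V → Set
    CAdj a c = ∃ λ i → ∃ λ xs → IsPathFrom a c xs ×
      All (λ z → BallV d (center i) z × z ≢ v₀ × z ≢ v₁) xs ×
      Linked (BallE d (center i)) xs

    SameCompC : V → V → Set
    SameCompC a c = ∃ λ zs → All CVert zs × Linked CAdj zs ×
      head zs ≡ just a × last zs ≡ just c

module Submission where

-- Walk from x to y in Ex_d(v₀,v₁) − v₀ − v₁ and keep, for the current copy (i , u), a vertex z of
-- C in the component of x′ together with a walk from z to u inside D_d of the i-th centre
-- avoiding v₀ and v₁. An edge of Ex simply extends that walk. When the walk passes
-- between two copies of u identified by a common label L, a shortest path to u from a core
-- vertex c, prefix L with a shortest v₀–v₁ path up to c: since such a path closes up to a walk
-- of length 2·dist(v₀,v₁) ≤ d, the result lies in both balls. Its last exit from {v₀,v₁} is a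
-- vertex w of C that is joined to z inside the old ball (so z w is an edge of C) and to u inside
-- the new one. Distance at least three is only needed to put the neighbours x′, y′ of v₀ into C.

open import Level using (0ℓ)
open import Data.Nat using (ℕ; zero; suc; _≤_; _+_; _*_; _∸_; z≤n; s≤s)
open import Data.Nat.Properties
  using (module ≤-Reasoning; ≤-refl; ≤-trans; ≤-reflexive; ≤-pred; n≤1+n; ≮⇒≥; +-mono-≤; +-identityʳ)
open import Data.Fin using (_≟_)
open import Data.Fin.Properties using (any?)
open import Data.Bool using (Bool; false; true; T)
open import Data.Unit using (tt)
open import Data.Empty using (⊥-elim)
open import Data.List using (List; []; _∷_; _++_; length; head; last)
open import Data.List.Properties using (length-++)
open import Data.List.Relation.Unary.All as All using (All; []; _∷_; universal-U)
open import Data.List.Relation.Unary.All.Properties using (++⁻ˡ; ¬Any⇒All¬)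
open import Data.List.Relation.Unary.Any using (here; there)
open import Data.List.Relation.Unary.AllPairs using ([]; _∷_)
open import Data.List.Relation.Unary.Linked as Linked using (Linked; []; [-]; _∷_)
open import Data.List.Relation.Unary.Unique.Propositional using (Unique)
open import Data.List.Membership.Propositional using (_∈_)
open import Data.List.Membership.Propositional.Properties using (∈-++⁺ˡ; ∈-++⁺ʳ)
import Data.List.Membership.DecPropositional as DecMembership
open import Data.Maybe using (just)
open import Data.Product using (∃; ∃₂; _×_; _,_; proj₁; proj₂)
open import Data.Sum using (_⊎_; inj₁; inj₂; swap)
open import Relation.Nullary using (¬_; Dec; yes; no)
open import Relation.Nullary.Decidable using (_×-dec_; _⊎-dec_; T?)
open import Relation.Unary using (Pred; U; ∁; _∩_; _⊆_; Decidable)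
open import Relation.Binary using (Rel; _⇒_; Symmetric; DecidableEquality)
open import Relation.Binary.Construct.Intersection renaming (_∩_ to _∩ᵇ_)
open import Function using (id; _∘_)
open import Relation.Binary.PropositionalEquality using (_≡_; _≢_; refl; sym; trans; cong; subst)
open import Defs

head-∈ : ∀ {A : Set} {a : A} xs → head xs ≡ just a → a ∈ xs
head-∈ (x ∷ xs) refl = here refl

last-∈ : ∀ {A : Set} {a : A} xs → last xs ≡ just a → a ∈ xs
last-∈ (x ∷ [])     refl = here refl
last-∈ (x ∷ y ∷ xs) eq   = there (last-∈ (y ∷ xs) eq)

module _ {A : Set} {R : Rel A 0ℓ} where

  Linked-middle : ∀ ys {a b zs} → Linked R (ys ++ a ∷ b ∷ zs) → R a b
  Linked-middle []           (e ∷ _) = e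
  Linked-middle (_ ∷ [])     (_ ∷ l) = Linked-middle [] l
  Linked-middle (_ ∷ y ∷ ys) (_ ∷ l) = Linked-middle (y ∷ ys) l

  Linked-fromMiddles : ∀ {xs} → (∀ {a b} ys zs → xs ≡ ys ++ a ∷ b ∷ zs → R a b) → Linked R xs
  Linked-fromMiddles {[]}         _      = []
  Linked-fromMiddles {x ∷ []}     _      = [-]
  Linked-fromMiddles {x ∷ y ∷ xs} middle =
    middle [] xs refl ∷ Linked-fromMiddles (λ ys zs eq → middle (x ∷ ys) zs (cong (x ∷_) eq))

  Linked-++⁻ˡ : ∀ xs {ys} → Linked R (xs ++ ys) → Linked R xs
  Linked-++⁻ˡ []           _       = []
  Linked-++⁻ˡ (x ∷ [])     _       = [-]
  Linked-++⁻ˡ (x ∷ y ∷ xs) (e ∷ l) = e ∷ Linked-++⁻ˡ (y ∷ xs) l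

module Walks {A : Set} where

  data Walk (P : Pred A 0ℓ) (R : Rel A 0ℓ) : A → A → Set where
    [_]   : ∀ {a} → P a → Walk P R a a
    _⟨_⟩_ : ∀ {a b c} → P a → R a b → Walk P R b c → Walk P R a c

  map : ∀ {P P′ R R′} → P ⊆ P′ → R ⇒ R′ → ∀ {a b} → Walk P R a b → Walk P′ R′ a b
  map f g [ pa ]       = [ f pa ]
  map f g (pa ⟨ e ⟩ p) = f pa ⟨ g e ⟩ map f g p

  module _ {P : Pred A 0ℓ} {R : Rel A 0ℓ} where

    vtail verts : ∀ {a b} → Walk P R a b → List A
    vtail [ _ ]       = []
    vtail (_ ⟨ _ ⟩ p) = verts p
    verts {a} p = a ∷ vtail p

    len : ∀ {a b} → Walk P R a b → ℕ
    len p = length (vtail p)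

    first : ∀ {a b} → Walk P R a b → P a
    first [ pa ]       = pa
    first (pa ⟨ _ ⟩ _) = pa

    All-verts : ∀ {a b} (p : Walk P R a b) → All P (verts p)
    All-verts [ pa ]       = pa ∷ []
    All-verts (pa ⟨ _ ⟩ p) = pa ∷ All-verts p

    Linked-verts : ∀ {a b} (p : Walk P R a b) → Linked R (verts p)
    Linked-verts [ _ ]       = [-]
    Linked-verts (_ ⟨ e ⟩ p) = e ∷ Linked-verts p

    last-verts : ∀ {a b} (p : Walk P R a b) → last (verts p) ≡ just b
    last-verts [ _ ]       = refl
    last-verts (_ ⟨ _ ⟩ p) = last-verts p

    toList : ∀ {a b} → Walk P R a b →
      ∃ λ xs → All P xs × Linked R xs × head xs ≡ just a × last xs ≡ just b
    toList p = verts p , All-verts p , Linked-verts p , refl , last-verts p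

    fromList : ∀ {a b} xs → All P xs → Linked R xs → head xs ≡ just a → last xs ≡ just b → Walk P R a b
    fromList (x ∷ [])     (px ∷ []) _       refl refl = [ px ]
    fromList (x ∷ y ∷ xs) (px ∷ ps) (e ∷ l) refl eq   = px ⟨ e ⟩ fromList (y ∷ xs) ps l refl eq

    verts-fromList : ∀ {a b} xs (ps : All P xs) (l : Linked R xs)
      (h : head xs ≡ just a) (t : last xs ≡ just b) →
      verts (fromList xs ps l h t) ≡ xs
    verts-fromList (x ∷ [])     (px ∷ []) _       refl refl = refl
    verts-fromList (x ∷ y ∷ xs) (px ∷ ps) (e ∷ l) refl eq   =
      cong (x ∷_) (verts-fromList (y ∷ xs) ps l refl eq)

    len-fromList : ∀ {a b} xs (ps : All P xs) (l : Linked R xs)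
      (h : head xs ≡ just a) (t : last xs ≡ just b) →
      len (fromList xs ps l h t) ≡ length xs ∸ 1
    len-fromList xs ps l h t = cong (λ ys → length ys ∸ 1) (verts-fromList xs ps l h t)

    fromList-upTo : ∀ {a c} xs → All P xs → Linked R xs → head xs ≡ just a → c ∈ xs → Walk P R a c
    fromList-upTo (x ∷ xs)     (px ∷ _)  _       refl (here refl) = [ px ]
    fromList-upTo (x ∷ y ∷ xs) (px ∷ ps) (e ∷ l) refl (there c∈) =
      px ⟨ e ⟩ fromList-upTo (y ∷ xs) ps l refl c∈

    infixr 5 _◅◅_
    _◅◅_ : ∀ {a b c} → Walk P R a b → Walk P R b c → Walk P R a c
    [ _ ]        ◅◅ q = q
    (pa ⟨ e ⟩ p) ◅◅ q = pa ⟨ e ⟩ (p ◅◅ q)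

    vtail-◅◅ : ∀ {a b c} (p : Walk P R a b) (q : Walk P R b c) → vtail (p ◅◅ q) ≡ vtail p ++ vtail q
    vtail-◅◅ [ _ ]       q = refl
    vtail-◅◅ (_ ⟨ _ ⟩ p) q = cong (_ ∷_) (vtail-◅◅ p q)

    len-◅◅ : ∀ {a b c} (p : Walk P R a b) (q : Walk P R b c) → len (p ◅◅ q) ≡ len p + len q
    len-◅◅ p q = trans (cong length (vtail-◅◅ p q)) (length-++ (vtail p))

    snoc : ∀ {a b c} → Walk P R a b → R b c → P c → Walk P R a c
    snoc [ pa ]       e pc = pa ⟨ e ⟩ [ pc ]
    snoc (pa ⟨ e ⟩ p) f pc = pa ⟨ e ⟩ snoc p f pc

    len-snoc : ∀ {a b c} (p : Walk P R a b) (e : R b c) (pc : P c) → len (snoc p e pc) ≡ suc (len p)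
    len-snoc [ _ ]       e pc = refl
    len-snoc (_ ⟨ _ ⟩ p) f pc = cong suc (len-snoc p f pc)

    module _ (R-sym : Symmetric R) where

      reverse : ∀ {a b} → Walk P R a b → Walk P R b a
      reverse [ pa ]       = [ pa ]
      reverse (pa ⟨ e ⟩ p) = snoc (reverse p) (R-sym e) pa

      len-reverse : ∀ {a b} (p : Walk P R a b) → len (reverse p) ≡ len p
      len-reverse [ _ ]        = refl
      len-reverse (pa ⟨ e ⟩ p) =
        trans (len-snoc (reverse p) (R-sym e) pa) (cong suc (len-reverse p))

    module _ (_≟_ : DecidableEquality A) where

      open DecMembership _≟_ using (_∈?_)

      suffix : ∀ {x a b} (p : Walk P R a b) → x ∈ verts p →
        ∃ λ (q : Walk P R x b) → (Unique (verts p) → Unique (verts q)) × len q ≤ len p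
      suffix p           (here refl) = p , (λ u → u) , ≤-refl
      suffix (_ ⟨ _ ⟩ p) (there x∈)  with suffix p x∈
      ... | q , unique , q≤p = q , (λ { (_ ∷ u) → unique u }) , ≤-trans q≤p (n≤1+n _)

      loopErase : ∀ {a b} (p : Walk P R a b) → ∃ λ (q : Walk P R a b) → Unique (verts q) × len q ≤ len p
      loopErase [ pa ] = [ pa ] , [] ∷ [] , z≤n
      loopErase {a} (pa ⟨ e ⟩ p) with loopErase p
      ... | q , uq , q≤p with a ∈? verts q
      ...   | yes a∈q =
        let q′ , unique , q′≤q = suffix q a∈q in q′ , unique uq , ≤-trans q′≤q (≤-trans q≤p (n≤1+n _))
      ...   | no  a∉q = pa ⟨ e ⟩ q , ¬Any⇒All¬ (verts q) a∉q ∷ uq , s≤s q≤p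

  module _ {P : Pred A 0ℓ} {R : Rel A 0ℓ} {X : Pred A 0ℓ} (X? : Decidable X) where

    avoidOrExit : ∀ {a b} → ¬ X b → Walk P R a b →
      Walk (P ∩ ∁ X) R a b ⊎ ∃₂ λ x w → X x × R x w × Walk (P ∩ ∁ X) R w b
    avoidOrExit ¬xb [ pb ] = inj₁ [ (pb , ¬xb) ]
    avoidOrExit {a} ¬xb (pa ⟨ e ⟩ p) with avoidOrExit ¬xb p | X? a
    ... | inj₂ exit  | _      = inj₂ exit
    ... | inj₁ avoid | yes xa = inj₂ (_ , _ , xa , e , avoid)
    ... | inj₁ avoid | no ¬xa = inj₁ ((pa , ¬xa) ⟨ e ⟩ avoid)

    lastExit : ∀ {a b} → X a → ¬ X b → Walk P R a b →
      ∃₂ λ x w → X x × R x w × Walk (P ∩ ∁ X) R w b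
    lastExit xa ¬xb p with avoidOrExit ¬xb p
    ... | inj₁ avoid = ⊥-elim (proj₂ (first avoid) xa)
    ... | inj₂ exit  = exit

open Walks

module _ {n : ℕ} (G : Graph n) where

  Adj-sym : Symmetric (Adj G)
  Adj-sym {a} {b} = subst T (Graph.sym G a b)

  Adj-irrefl : ∀ {a} → ¬ Adj G a a
  Adj-irrefl {a} = subst T (Graph.irrefl G a)

  GWalk : V G → V G → Set
  GWalk = Walk U (Adj G)

  module _ (t : V G) where

    walk≤? : ∀ j a → Dec (∃ λ (p : GWalk a t) → len p ≤ j)
    walk≤? j a with a ≟ t
    ... | yes refl = yes ([ tt ] , z≤n)
    walk≤? zero a    | no a≢t = no λ { ([ _ ] , _) → a≢t refl ; (_ ⟨ _ ⟩ _ , ()) }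
    walk≤? (suc j) a | no a≢t with any? (λ b → T? (Graph.adj G a b) ×-dec walk≤? j b)
    ... | yes (_ , e , p , p≤j) = yes (tt ⟨ e ⟩ p , s≤s p≤j)
    ... | no none = no λ { ([ _ ] , _)           → a≢t refl
                         ; (_ ⟨ e ⟩ p , s≤s p≤j) → none (_ , e , p , p≤j) }

    shortestWalk : ∀ j {a} (p : GWalk a t) → len p ≤ j →
      ∃ λ (q : GWalk a t) → ∀ (r : GWalk a t) → len q ≤ len r
    shortestWalk zero    p p≤0 = p , λ _ → ≤-trans p≤0 z≤n
    shortestWalk (suc j) {a} p p≤j with walk≤? j a
    ... | yes (q , q≤j) = shortestWalk j q q≤j
    ... | no none = p , λ r → ≮⇒≥ (λ r<p → none (r , ≤-pred (≤-trans r<p p≤j)))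

  fromIsWalk : ∀ {a b xs} → IsWalkFrom G a b xs → GWalk a b
  fromIsWalk {xs = xs} (l , h , t) = fromList xs (universal-U xs) l h t

  len-fromIsWalk : ∀ {a b xs} (w : IsWalkFrom G a b xs) → len (fromIsWalk w) ≡ wlen G xs
  len-fromIsWalk {xs = xs} (l , h , t) = len-fromList xs (universal-U xs) l h t

  shortestPath-exists : ∀ {a b k} → Dist≤ G a b k → ∃ (ShortestPath G a b)
  shortestPath-exists {b = b} (_ , w , _) with shortestWalk b _ (fromIsWalk w) ≤-refl
  ... | s , minimal with loopErase _≟_ s
  ... | q , unique , q≤s = verts q , ((Linked-verts q , refl , last-verts q) , unique) , shortest
    where
    shortest : ∀ ys → IsWalkFrom G _ b ys → len q ≤ wlen G ys
    shortest ys w′ =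
      ≤-trans q≤s (≤-trans (minimal (fromIsWalk w′)) (≤-reflexive (len-fromIsWalk w′)))

  module _ (d : ℕ) where

    BallE⇒Adj : ∀ {z a b} → BallE G d z a b → Adj G a b
    BallE⇒Adj (_ , (_ , l , _) , _ , _ , inj₁ (ys , _ , refl)) = Linked-middle ys l
    BallE⇒Adj (_ , (_ , l , _) , _ , _ , inj₂ (ys , _ , refl)) = Adj-sym (Linked-middle ys l)

    BallE-sym : ∀ {z} → Symmetric (BallE G d z)
    BallE-sym (w , c , w≤d , z∈ , e) = w , c , w≤d , z∈ , swap e

    BallE⇒BallV : ∀ {z a b} → BallE G d z a b → BallV G d z b
    BallE⇒BallV (_ , c , w≤d , z∈ , inj₁ (ys , _ , refl)) =
      _ , c , w≤d , z∈ , ∈-++⁺ʳ ys (there (here refl))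
    BallE⇒BallV (_ , c , w≤d , z∈ , inj₂ (ys , _ , refl)) =
      _ , c , w≤d , z∈ , ∈-++⁺ʳ ys (here refl)

    closedWalk⇒InBall : ∀ {z W} → ClosedWalk G W → wlen G W ≤ d → z ∈ W → InBall G d z W
    closedWalk⇒InBall c W≤d z∈ =
      All.tabulate (λ x∈ → _ , c , W≤d , z∈ , x∈) ,
      Linked-fromMiddles (λ ys zs eq → _ , c , W≤d , z∈ , inj₁ (ys , zs , eq))

    InBall-++⁻ˡ : ∀ {z} xs {ys} → InBall G d z (xs ++ ys) → InBall G d z xs
    InBall-++⁻ˡ xs (vs , es) = ++⁻ˡ xs vs , Linked-++⁻ˡ xs es

module ExplorerFacts {n : ℕ} (G : Graph n) (d : ℕ) (v₀ v₁ : V G)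
  (k : ℕ) (2k≤d : 2 * k ≤ d) (dist : Dist≤ G v₀ v₁ k) where

  open Explorer G d v₀ v₁

  shortestPath-inBall : ∀ {Q} → ShortestPath G v₀ v₁ Q → ∀ i → InBall G d (center i) Q
  shortestPath-inBall {Q} ((w@(_ , _ , Q-last) , _) , minimal) i =
    InBall-++⁻ˡ G d Q
      (subst (InBall G d (center i)) around≡ (closedWalk⇒InBall G d closed around≤d (center∈ i)))
    where
    open ≤-Reasoning
    q = fromIsWalk G w
    back = reverse (Adj-sym G) q
    around = q ◅◅ back

    around≡ : verts around ≡ Q ++ vtail back
    around≡ =
      trans (cong (v₀ ∷_) (vtail-◅◅ q back)) (cong (_++ vtail back) (verts-fromList Q _ _ _ _))

    closed : ClosedWalk G (verts around)
    closed = v₀ , Linked-verts around , refl , last-verts around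

    q≤k : len q ≤ k
    q≤k = let ys , w′ , ys≤k = dist in
      ≤-trans (≤-reflexive (len-fromIsWalk G w)) (≤-trans (minimal ys w′) ys≤k)

    around≤d : len around ≤ d
    around≤d = begin
      len around           ≡⟨ len-◅◅ q back ⟩
      len q + len back     ≡⟨ cong (len q +_) (len-reverse (Adj-sym G) q) ⟩
      len q + len q        ≤⟨ +-mono-≤ q≤k q≤k ⟩
      k + k                ≡⟨ cong (k +_) (sym (+-identityʳ k)) ⟩
      2 * k                ≤⟨ 2k≤d ⟩
      d                    ∎

    center∈ : ∀ i → center i ∈ verts around
    center∈ false = here refl
    center∈ true  = subst (v₁ ∈_) (sym around≡) (∈-++⁺ˡ (last-∈ Q Q-last))

  IsRoot : Pred (V G) 0ℓ
  IsRoot z = z ≡ v₀ ⊎ z ≡ v₁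

  IsRoot? : Decidable IsRoot
  IsRoot? z = z ≟ v₀ ⊎-dec z ≟ v₁

  Inner : Pred (V G) 0ℓ
  Inner z = z ≢ v₀ × z ≢ v₁

  ¬IsRoot⇒Inner : ∁ IsRoot ⊆ Inner
  ¬IsRoot⇒Inner ¬root = ¬root ∘ inj₁ , ¬root ∘ inj₂

  Inner⇒¬IsRoot : Inner ⊆ ∁ IsRoot
  Inner⇒¬IsRoot (≢v₀ , _) (inj₁ ≡v₀) = ≢v₀ ≡v₀
  Inner⇒¬IsRoot (_ , ≢v₁) (inj₂ ≡v₁) = ≢v₁ ≡v₁

  Q₀ : List (V G)
  Q₀ = proj₁ (shortestPath-exists G dist)

  Q₀-shortest : ShortestPath G v₀ v₁ Q₀
  Q₀-shortest = proj₂ (shortestPath-exists G dist)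

  root∈Q₀ : ∀ {r} → IsRoot r → r ∈ Q₀
  root∈Q₀ (inj₁ refl) = head-∈ Q₀ (proj₁ (proj₂ (proj₁ (proj₁ Q₀-shortest))))
  root∈Q₀ (inj₂ refl) = last-∈ Q₀ (proj₂ (proj₂ (proj₁ (proj₁ Q₀-shortest))))

  -- Q₀ puts v₀ and v₁ into the core; this is what identifies the two copies of each of them.
  root-label : ∀ {r} → IsRoot r → ∀ i → Label i r (r ∷ [])
  root-label {r} root i =
    (r , (Q₀ , Q₀-shortest , root∈Q₀ root) , (([-] , refl , refl) , [] ∷ []) , λ _ _ _ _ → z≤n) ,
    (All.lookup (proj₁ (shortestPath-inBall Q₀-shortest i)) (root∈Q₀ root) ∷ [] , [-])

  root-ident : ∀ {r} → IsRoot r → ∀ i j → Ident (i , r) (j , r)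
  root-ident root i j = refl , inj₂ (_ , root-label root i , root-label root j)

  ¬Removed⇒Inner : ∀ {i u} → ¬ Removed (i , u) → Inner u
  ¬Removed⇒Inner {i} ¬removed =
    (λ { refl → ¬removed (inj₁ (root-ident (inj₁ refl) i false)) }) ,
    (λ { refl → ¬removed (inj₂ (root-ident (inj₂ refl) i true)) })

  Ident-sym : ∀ {p q} → Ident p q → Ident q p
  Ident-sym (refl , inj₁ refl)          = refl , inj₁ refl
  Ident-sym (refl , inj₂ (L , Lp , Lq)) = refl , inj₂ (L , Lq , Lp)

  BallWalk : Bool → V G → V G → Set
  BallWalk i = Walk (BallV G d (center i) ∩ Inner) (BallE G d (center i))

  BothBallsWalk : Bool → Bool → V G → V G → Set
  BothBallsWalk i j =
    Walk (BallV G d (center i) ∩ BallV G d (center j)) (BallE G d (center i) ∩ᵇ BallE G d (center j))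

  CWalk : V G → V G → Set
  CWalk = Walk CVert CAdj

  ballWalk⇒CAdj : ∀ {i z w} → BallWalk i z w → CAdj z w
  ballWalk⇒CAdj {i} p with loopErase _≟_ p
  ... | q , unique , _ =
    i , verts q , ((Linked.map (BallE⇒Adj G d) (Linked-verts q) , refl , last-verts q) , unique) ,
    All-verts q , Linked-verts q

  exit⇒CVert : ∀ {x w} → IsRoot x → Adj G x w → Inner w → CVert w
  exit⇒CVert (inj₁ refl) e (≢v₀ , ≢v₁) = ≢v₀ , ≢v₁ , inj₁ (Adj-sym G e)
  exit⇒CVert (inj₂ refl) e (≢v₀ , ≢v₁) = ≢v₀ , ≢v₁ , inj₂ (Adj-sym G e)

  inBothBalls : ∀ {i j xs} → InBall G d (center i) xs → InBall G d (center j) xs →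
    All (BallV G d (center i) ∩ BallV G d (center j)) xs ×
    Linked (BallE G d (center i) ∩ᵇ BallE G d (center j)) xs
  inBothBalls (vᵢ , eᵢ) (vⱼ , eⱼ) = All.zip (vᵢ , vⱼ) , Linked.zip (eᵢ , eⱼ)

  sharedLabel⇒walk : ∀ {i j u L} → Label i u L → Label j u L → BothBallsWalk i j v₀ u
  sharedLabel⇒walk {i} {j} {L = L}
    ((_ , (Q , Q-shortest@(((_ , Q-head , _) , _) , _) , c∈Q) , ((_ , L-head , L-last) , _) , _) , L-inBallᵢ)
    (_ , L-inBallⱼ) =
      let Qv , Qe = inBothBalls (shortestPath-inBall Q-shortest i) (shortestPath-inBall Q-shortest j)
          Lv , Le = inBothBalls L-inBallᵢ L-inBallⱼ
      in fromList-upTo Q Qv Qe Q-head c∈Q ◅◅ fromList L Lv Le L-head L-last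

  sharedLabel⇒exit : ∀ {i j u L} → Inner u → Label i u L → Label j u L →
    ∃ λ w → CVert w × BallWalk i w u × BallWalk j w u
  sharedLabel⇒exit inner Lᵢ Lⱼ
    with lastExit IsRoot? (inj₁ refl) (Inner⇒¬IsRoot inner) (sharedLabel⇒walk Lᵢ Lⱼ)
  ... | _ , w , root , (eᵢ , _) , p =
    w , exit⇒CVert root (BallE⇒Adj G d eᵢ) (¬IsRoot⇒Inner (proj₂ (first p))) ,
    map (λ { ((vᵢ , _) , ¬root) → vᵢ , ¬IsRoot⇒Inner ¬root }) proj₁ p ,
    map (λ { ((_ , vⱼ) , ¬root) → vⱼ , ¬IsRoot⇒Inner ¬root }) proj₂ p

  Reached : V G → ExPre → Set
  Reached x p = ∃ λ z → CVert z × CWalk x z × BallWalk (proj₁ p) z (proj₂ p)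

  reached-ident : ∀ {x i u j u′} → Inner u → Ident (i , u) (j , u′) →
    Reached x (i , u) → Reached x (j , u′)
  reached-ident _     (refl , inj₁ refl)          reached = reached
  reached-ident inner (refl , inj₂ (_ , Lᵢ , Lⱼ)) (z , _ , cw , bw)
    with sharedLabel⇒exit inner Lᵢ Lⱼ
  ... | w , cw′ , pᵢ , pⱼ =
    w , cw′ , snoc cw (ballWalk⇒CAdj (bw ◅◅ reverse (BallE-sym G d) pᵢ)) cw′ , pⱼ

  reached-step : ∀ {x r s} → ¬ Removed r → ¬ Removed s → Ident r s ⊎ ExAdj r s →
    Reached x r → Reached x s
  reached-step {r = _ , _} {s = _ , _} ¬removedᵣ _ (inj₁ id) =
    reached-ident (¬Removed⇒Inner ¬removedᵣ) id
  reached-step {r = _ , _} {s = _ , _} ¬removedᵣ ¬removedₛ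
    (inj₂ (_ , _ , _ , idᵣ , idₛ@(refl , _) , e)) reached
    with reached-ident (¬Removed⇒Inner ¬removedᵣ) idᵣ reached
  ... | z , cz , cw , bw =
    reached-ident innerₛ (Ident-sym idₛ) (z , cz , cw , snoc bw e (BallE⇒BallV G d e , innerₛ))
    where
    innerₛ = ¬Removed⇒Inner ¬removedₛ

  reached-along : ∀ {x r s} → Walk (λ r → IsExV r × ¬ Removed r) (λ r s → Ident r s ⊎ ExAdj r s) r s →
    Reached x r → Reached x s
  reached-along [ _ ]         = id
  reached-along (gr ⟨ e ⟩ p) = reached-along p ∘ reached-step (proj₂ gr) (proj₂ (first p)) e

  neighbour⇒CVert : ¬ Dist≤ G v₀ v₁ 2 → ∀ {i u} → ExAdj (i , u) exv₀ → CVert u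
  neighbour⇒CVert far (_ , _ , _ , (refl , _) , (refl , _) , e) = ≢v₀ , ≢v₁ , inj₁ u~v₀
    where
    u~v₀ = BallE⇒Adj G d e
    ≢v₀ : _ ≢ v₀
    ≢v₀ refl = Adj-irrefl G u~v₀
    ≢v₁ : _ ≢ v₁
    ≢v₁ refl = far (v₀ ∷ v₁ ∷ [] , (Adj-sym G u~v₀ ∷ [-] , refl , refl) , s≤s z≤n)

lemma3p10 : (d n : ℕ) (G : Graph n) (v₀ v₁ : V G) →
    (∃ λ k → 2 * k ≤ d × Dist≤ G v₀ v₁ k) →
    ¬ Dist≤ G v₀ v₁ 2 →
    (x y : Explorer.ExPre G d v₀ v₁) →
    Explorer.IsExV G d v₀ v₁ x → Explorer.IsExV G d v₀ v₁ y →
    Explorer.ExAdj G d v₀ v₁ x (Explorer.exv₀ G d v₀ v₁) →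
    Explorer.ExAdj G d v₀ v₁ y (Explorer.exv₀ G d v₀ v₁) →
    Explorer.SameCompExMinus G d v₀ v₁ x y →
    Explorer.SameCompC G d v₀ v₁ (proj₂ x) (proj₂ y)
lemma3p10 d n G v₀ v₁ (k , 2k≤d , dist) far (i , x) (_ , y) x∈Ex _ x~v₀ y~v₀
  (ps , good , linked , h , t) =
  let _ , _ , cw , bw = reached-along (fromList ps good linked h t) start
  in toList (snoc cw (ballWalk⇒CAdj bw) (neighbour⇒CVert far y~v₀))
  where
  open ExplorerFacts G d v₀ v₁ k 2k≤d dist
  cx = neighbour⇒CVert far x~v₀
  start : Reached x (i , x)
  start = x , cx , [ cx ] , [ (x∈Ex , proj₁ cx , proj₁ (proj₂ cx)) ]
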